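{- Let $q$ be a prime power, $t\ge 1$, and let $\mathcal P$ be a vector space partition of $V(2t,q)$ containing exactly $q^t+1-a$ subspaces of dimension $t$ and exactly $m_d$ subspaces of dimension $d$, where $t/2<d<t$. If there is a $t$-spread of $V(2t,q)$ containing all $t$-dimensional members of $\mathcal P$, then \[ a\ge\min\big(m_d,\;q^{\lceil d/2\rceil}+1\big). \]
   Context: A vector space partition of $V(n,q)$ (the $n$-dimensional vector space over $\mathrm{GF}(q)$) is a collection of subspaces, all of positive dimension, such that every nonzero vector lies in exactly one member. A $t$-spread of $V$ is a vector space partition of $V$ all of whose members have dimension $t$. -}

module Defs where

open import Level using (0ℓ)
open import Data.Nat using (ℕ; zero; suc; _^_; _≟_)
open import Data.Nat.Primality using (Prime)
open import Data.Fin using (Fin)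
open import Data.Vec using (Vec; []; _∷_; zipWith; replicate; map)
open import Data.List using (List; length; lookup; filter)
open import Data.List.Relation.Unary.Any using (Any)
open import Data.List.Relation.Unary.All using (All)
open import Data.Product using (Σ; ∃; _×_; _,_)
open import Relation.Nullary using (¬_)
open import Relation.Binary.PropositionalEquality using (_≡_)
open import Algebra.Structures using (IsCommutativeRing)
open import Function.Bundles using (_↔_)

IsPrimePower : ℕ → Set
IsPrimePower q = Σ ℕ λ p → Σ ℕ λ k → Prime p × (q ≡ p ^ suc k)

record FiniteField (q : ℕ) : Set₁ where
  infixl 6 _+_
  infixl 7 _*_
  field
    Carrier : Set
    _+_ _*_ : Carrier → Carrier → Carrier
    -_ : Carrier → Carrier
    0# 1# : Carrier
    isCommutativeRing : IsCommutativeRing _≡_ _+_ _*_ -_ 0# 1#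
    0≢1 : ¬ (0# ≡ 1#)
    inverse : ∀ x → ¬ (x ≡ 0#) → ∃ λ y → x * y ≡ 1#
    enumeration : Fin q ↔ Carrier

module VectorSpace {q : ℕ} (F : FiniteField q) where
  open FiniteField F

  V : ℕ → Set
  V n = Vec Carrier n

  zeroV : ∀ {n} → V n
  zeroV = replicate _ 0#

  _+V_ : ∀ {n} → V n → V n → V n
  _+V_ = zipWith _+_

  _·V_ : ∀ {n} → Carrier → V n → V n
  c ·V v = map (c *_) v

  lincomb : ∀ {n d} → Vec Carrier d → Vec (V n) d → V n
  lincomb [] [] = zeroV
  lincomb (c ∷ cs) (b ∷ bs) = (c ·V b) +V lincomb cs bs

  LinIndep : ∀ {n d} → Vec (V n) d → Set
  LinIndep {d = d} B = ∀ (c : Vec Carrier d) → lincomb c B ≡ zeroV → c ≡ replicate d 0#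

  record Subspace (n : ℕ) : Set where
    constructor subspace
    field
      dim : ℕ
      basis : Vec (V n) dim
      indep : LinIndep basis
  open Subspace public

  dimension : ∀ {n} → Subspace n → ℕ
  dimension S = dim S

  _∈S_ : ∀ {n} → V n → Subspace n → Set
  v ∈S S = ∃ λ (c : Vec Carrier (dim S)) → v ≡ lincomb c (basis S)

  SameSubspace : ∀ {n} → Subspace n → Subspace n → Set
  SameSubspace {n} S T = ∀ (v : V n) → (v ∈S S → v ∈S T) × (v ∈S T → v ∈S S)

  IsVSPartition : ∀ {n} → List (Subspace n) → Set
  IsVSPartition {n} P =
    All (λ S → 1 Data.Nat.≤ dim S) P ×
    (∀ (v : V n) → ¬ (v ≡ zeroV) →
       ∃ λ (i : Fin (length P)) → v ∈S lookup P i ×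
         (∀ (j : Fin (length P)) → v ∈S lookup P j → j ≡ i))

  IsSpread : ∀ {n} → ℕ → List (Subspace n) → Set
  IsSpread t P = IsVSPartition P × All (λ S → dim S ≡ t) P

  count : ∀ {n} → ℕ → List (Subspace n) → ℕ
  count d P = length (filter (λ S → dim S ≟ d) P)

module Submission where

open import Defs
open import Data.Nat using (ℕ; _+_; _*_; _^_; _<_; _≤_; ⌈_/2⌉; _⊓_)
open import Data.List using (List)
open import Data.List.Relation.Unary.All using (All)
open import Data.List.Relation.Unary.Any using (Any)
open import Data.Product using (Σ; _×_; _,_)
open import Relation.Binary.PropositionalEquality using (_≡_; subst)
open import Relation.Nullary using (yes; no)
import Data.Nat.Properties as ℕP

-- Proposition 8.  Let S be a t-spread of V(2t,q) (s members) containing the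
-- t-dimensional members of the partition P (ct of them, ct + a = qᵗ + 1), and let
-- t/2 < d < t.
--   * Counting vectors, s ≤ qᵗ + 1; each t-member of P is a spread member, so at
--     most a spread members are not of this form ("unmatched").
--   * A d-member D of P meets only unmatched spread members, hence at most a of
--     them.  The intersections D ∩ W have pairwise dimension sum ≤ d and cover D,
--     so if a ≤ q^⌈d/2⌉ the inequality smallPiecesBound forces D ⊆ W for one W.
--   * Two d-members cannot share a spread member (2d > t), so then count d P ≤ a;
--     otherwise a ≥ q^⌈d/2⌉ + 1.  Either way min(m_d, q^⌈d/2⌉ + 1) ≤ a.

module Arithmetic where

  open import Data.Nat
  open import Data.Nat.Properties
  open import Data.Nat.Tactic.RingSolver using (solve-∀)
  open import Data.Fin using (Fin; zero; suc; splitAt; join)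
  import Data.Fin.Properties as FinP
  open import Data.Sum using (inj₁; inj₂; [_,_]′)
  open import Data.Product using (Σ; ∃; _,_)
  open import Relation.Nullary using (¬_; yes; no)
  open import Relation.Binary.PropositionalEquality

  ∑ : (m : ℕ) → (Fin m → ℕ) → ℕ
  ∑ zero    g = 0
  ∑ (suc m) g = g zero + ∑ m (λ j → g (suc j))

  ∑-join : ∀ m (g : Fin m → ℕ) → Σ (Fin m) (λ j → Fin (g j)) → Fin (∑ m g)
  ∑-join (suc m) g (zero  , i) = join (g zero) (∑ m (λ j → g (suc j))) (inj₁ i)
  ∑-join (suc m) g (suc j , i) =
    join (g zero) (∑ m (λ j → g (suc j))) (inj₂ (∑-join m (λ j → g (suc j)) (j , i)))

  ∑-split : ∀ m (g : Fin m → ℕ) → Fin (∑ m g) → Σ (Fin m) (λ j → Fin (g j))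
  ∑-split (suc m) g x =
    [ (λ i → zero , i)
    , (λ y → let (j , i) = ∑-split m (λ j → g (suc j)) y in suc j , i)
    ]′ (splitAt (g zero) x)

  ∑-split-join : ∀ m g p → ∑-split m g (∑-join m g p) ≡ p
  ∑-split-join (suc m) g (zero , i)
    rewrite FinP.splitAt-↑ˡ (g zero) i (∑ m (λ j → g (suc j))) = refl
  ∑-split-join (suc m) g (suc j , i)
    rewrite FinP.splitAt-↑ʳ (g zero) (∑ m (λ j → g (suc j))) (∑-join m (λ j → g (suc j)) (j , i))
          | ∑-split-join m (λ j → g (suc j)) (j , i) = refl

  ∑-join-split : ∀ m g x → ∑-join m g (∑-split m g x) ≡ x
  ∑-join-split (suc m) g x with splitAt (g zero) x in eq
  ... | inj₁ i = trans (cong (join (g zero) _) (sym eq)) (FinP.join-splitAt (g zero) _ x)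
  ... | inj₂ y = trans (cong (λ z → join (g zero) _ (inj₂ z)) (∑-join-split m (λ j → g (suc j)) y))
                       (trans (cong (join (g zero) _) (sym eq)) (FinP.join-splitAt (g zero) _ x))

  ∑-const : ∀ m c → ∑ m (λ _ → c) ≡ m * c
  ∑-const zero    c = refl
  ∑-const (suc m) c = cong (c +_) (∑-const m c)

  ∑-cong : ∀ m {g h : Fin m → ℕ} → (∀ j → g j ≡ h j) → ∑ m g ≡ ∑ m h
  ∑-cong zero    e = refl
  ∑-cong (suc m) e = cong₂ _+_ (e zero) (∑-cong m (λ j → e (suc j)))

  ∑-≤-const : ∀ m (g : Fin m → ℕ) c → (∀ j → g j ≤ c) → ∑ m g ≤ m * c
  ∑-≤-const zero    g c h = z≤n
  ∑-≤-const (suc m) g c h = +-mono-≤ (h zero) (∑-≤-const m _ c (λ j → h (suc j)))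

  ∑-≤-except : ∀ m (g : Fin (suc m) → ℕ) b c → (∀ j → ¬ j ≡ b → g j ≤ c) → ∑ (suc m) g ≤ g b + m * c
  ∑-≤-except m g zero c h = +-monoʳ-≤ (g zero) (∑-≤-const m _ c (λ j → h (suc j) (λ ())))
  ∑-≤-except (suc m) g (suc b) c h = begin
      g zero + ∑ (suc m) (λ j → g (suc j))  ≤⟨ +-mono-≤ (h zero (λ ())) rest ⟩
      c + (g (suc b) + m * c)               ≡⟨ sym (+-assoc c _ _) ⟩
      c + g (suc b) + m * c                 ≡⟨ cong (_+ m * c) (+-comm c _) ⟩
      g (suc b) + c + m * c                 ≡⟨ +-assoc (g (suc b)) c _ ⟩
      g (suc b) + (c + m * c)               ∎
    where
      open ≤-Reasoning
      rest = ∑-≤-except m (λ j → g (suc j)) b c (λ j j≢b → h (suc j) (λ e → j≢b (FinP.suc-injective e)))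

  argmax : ∀ m (f : Fin (suc m) → ℕ) → ∃ λ b → ∀ j → f j ≤ f b
  argmax zero    f = zero , λ { zero → ≤-refl }
  argmax (suc m) f with argmax m (λ j → f (suc j))
  ... | b , hb with f zero ≤? f (suc b)
  ...   | yes le = suc b , λ { zero → le ; (suc j) → hb j }
  ...   | no nle = zero  , λ { zero → ≤-refl ; (suc j) → ≤-trans (hb j) (<⇒≤ (≰⇒> nle)) }

  ⌈/2⌉+k≤ : ∀ d k → k + k ≤ d → ⌈ d /2⌉ + k ≤ d
  ⌈/2⌉+k≤ d zero _ = subst (_≤ d) (sym (+-identityʳ _)) (⌈n/2⌉≤n d)
  ⌈/2⌉+k≤ zero (suc k) ()
  ⌈/2⌉+k≤ (suc zero) (suc k) (s≤s le) with subst (_≤ 0) (+-suc k k) le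
  ... | ()
  ⌈/2⌉+k≤ (suc (suc d)) (suc k) (s≤s le) =
    s≤s (subst (_≤ suc d) (sym (+-suc ⌈ d /2⌉ k))
      (s≤s (⌈/2⌉+k≤ d k (≤-pred (subst (_≤ suc d) (+-suc k k) le)))))

  ⌈/2⌉≤ : ∀ d k → d < 2 * k → ⌈ d /2⌉ ≤ k
  ⌈/2⌉≤ d k lt = subst (⌈ d /2⌉ ≤_) (sym (n≡⌈n+n/2⌉ k))
    (⌈n/2⌉-mono (≤-trans (<⇒≤ lt) (≤-reflexive (cong (k +_) (+-identityʳ k)))))

  ⌈/2⌉-positive : ∀ d → 1 ≤ d → 1 ≤ ⌈ d /2⌉
  ⌈/2⌉-positive (suc d) _ = s≤s z≤n

  module Powers (q : ℕ) (2≤q : 2 ≤ q) where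

    q^-positive : ∀ k → 1 ≤ q ^ k
    q^-positive zero    = s≤s z≤n
    q^-positive (suc k) = *-mono-≤ (≤-trans (s≤s z≤n) 2≤q) (q^-positive k)

    q^-≥2 : ∀ k → 1 ≤ k → 2 ≤ q ^ k
    q^-≥2 (suc k) _ = *-mono-≤ 2≤q (q^-positive k)

    q^-mono : ∀ {j k} → j ≤ k → q ^ j ≤ q ^ k
    q^-mono {zero} {k} z≤n = q^-positive k
    q^-mono (s≤s le)       = *-monoʳ-≤ q (q^-mono le)

    uniformBound : ∀ m A X Q → m ≤ A → 2 ≤ A → 1 ≤ X → A * X ≤ Q → m * (X ∸ 1) < Q ∸ 1
    uniformBound m (suc zero) _ _ _ (s≤s ()) _ _
    uniformBound m (suc (suc a)) (suc x) Q m≤A _ _ AX≤Q = begin-strict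
        m * x                      ≤⟨ *-monoˡ-≤ x m≤A ⟩
        A * x                      <⟨ s≤s (m≤n+m (A * x) a) ⟩
        suc (suc a) + A * x ∸ 1    ≡⟨ cong (_∸ 1) (sym (*-suc A x)) ⟩
        A * suc x ∸ 1              ≤⟨ ∸-monoˡ-≤ 1 AX≤Q ⟩
        Q ∸ 1                      ∎
      where
        open ≤-Reasoning
        A = suc (suc a)

    dominatedBound : ∀ m X Y → m < X → 2 ≤ Y → (X ∸ 1) + m * (Y ∸ 1) < X * Y ∸ 1
    dominatedBound m (suc x) (suc zero) _ (s≤s ())
    dominatedBound m (suc x) (suc (suc y')) (s≤s m≤x) _ = begin-strict
        x + m * y           ≤⟨ +-monoʳ-≤ x (*-monoˡ-≤ y m≤x) ⟩
        x + x * y           <⟨ m<n+m (x + x * y) {y} (s≤s z≤n) ⟩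
        y + (x + x * y)     ≡⟨ cong (y +_) (sym (*-suc x y)) ⟩
        y + x * suc y       ∎
      where
        open ≤-Reasoning
        y = suc y'

    -- The key inequality: at most q^⌈d/2⌉ exponents f j < d, any two of which sum to
    -- at most d, satisfy ∑ (q^(f j) - 1) < q^d - 1.  If the largest exponent k has
    -- 2k ≤ d, every term is at most q^k - 1 (uniformBound); otherwise the others are
    -- at most q^(d-k) - 1 and there are fewer than q^k of them (dominatedBound).
    smallPiecesBound : ∀ m d (f : Fin m → ℕ) → 1 ≤ d → m ≤ q ^ ⌈ d /2⌉ → (∀ j → f j < d) →
      (∀ j j' → ¬ j ≡ j' → f j + f j' ≤ d) → ∑ m (λ j → q ^ f j ∸ 1) < q ^ d ∸ 1
    smallPiecesBound zero d f 1≤d _ _ _ = ∸-monoˡ-≤ 1 (q^-≥2 d 1≤d)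
    smallPiecesBound (suc m) d f 1≤d m≤ f<d pairwise with argmax m f
    ... | b , f≤fb with f b + f b ≤? d
    ...   | yes 2k≤d = begin-strict
             ∑ (suc m) g              ≤⟨ ∑-≤-const (suc m) g (q ^ k ∸ 1) (λ j → ∸-monoˡ-≤ 1 (q^-mono (f≤fb j))) ⟩
             suc m * (q ^ k ∸ 1)      <⟨ uniformBound (suc m) (q ^ ⌈ d /2⌉) (q ^ k) (q ^ d) m≤ (q^-≥2 ⌈ d /2⌉ (⌈/2⌉-positive d 1≤d))
                                           (q^-positive k) (subst (_≤ q ^ d) (^-distribˡ-+-* q ⌈ d /2⌉ k) (q^-mono (⌈/2⌉+k≤ d k 2k≤d))) ⟩
             q ^ d ∸ 1                ∎
      where
        open ≤-Reasoning
        k = f b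
        g = λ j → q ^ f j ∸ 1
    ...   | no 2k≰d = begin-strict
             ∑ (suc m) g                              ≤⟨ ∑-≤-except m g b (q ^ (d ∸ k) ∸ 1) others ⟩
             (q ^ k ∸ 1) + m * (q ^ (d ∸ k) ∸ 1)      <⟨ dominatedBound m (q ^ k) (q ^ (d ∸ k)) m<q^k (q^-≥2 (d ∸ k) (m<n⇒0<n∸m (f<d b))) ⟩
             q ^ k * q ^ (d ∸ k) ∸ 1                  ≡⟨ cong (_∸ 1) (sym (^-distribˡ-+-* q k (d ∸ k))) ⟩
             q ^ (k + (d ∸ k)) ∸ 1                    ≡⟨ cong (λ z → q ^ z ∸ 1) (m+[n∸m]≡n (<⇒≤ (f<d b))) ⟩
             q ^ d ∸ 1                                ∎
      where
        open ≤-Reasoning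
        k = f b
        g = λ j → q ^ f j ∸ 1
        others : ∀ j → ¬ j ≡ b → g j ≤ q ^ (d ∸ k) ∸ 1
        others j j≢b = ∸-monoˡ-≤ 1 (q^-mono (m+n≤o⇒m≤o∸n (f j) (pairwise j b j≢b)))
        m<q^k : m < q ^ k
        m<q^k = ≤-trans m≤ (q^-mono (⌈/2⌉≤ d k (subst (d <_) (cong (k +_) (sym (+-identityʳ k))) (≰⇒> 2k≰d))))

  -- Solving the vector count 1 + s (Q - 1) ≤ Q² of a spread for its size s.
  spreadSizeBound : ∀ s Q → 2 ≤ Q → suc (s * (Q ∸ 1)) ≤ Q * Q → s ≤ suc Q
  spreadSizeBound s (suc zero) (s≤s ()) _
  spreadSizeBound s (suc (suc y)) _ le =
    *-cancelʳ-≤ s (suc (suc (suc y))) (suc y) (≤-pred (subst (suc (s * suc y) ≤_) (square (suc y)) le))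
    where
      square : ∀ x → suc x * suc x ≡ suc (suc (suc x) * x)
      square = solve-∀

module LinearAlgebra {q : ℕ} (F : FiniteField q) where

  open import Level using (0ℓ)
  open import Data.Nat as ℕ using (zero; suc; _∸_; z≤n; s≤s)
  import Data.Nat.Properties as ℕP
  open import Data.Fin as Fin using (Fin; zero; suc; combine; remQuot; punchIn; punchOut)
  import Data.Fin.Properties as FinP
  open import Data.Vec using (Vec; []; _∷_; map; take; drop; _++_)
  open import Data.Vec.Properties
    using (≡-dec; zipWith-assoc; zipWith-comm; zipWith-identityˡ; zipWith-identityʳ;
           zipWith-inverseˡ; zipWith-inverseʳ; take++drop≡id)
  open import Data.Product using (Σ; ∃; _×_; _,_; proj₁; proj₂)
  open import Data.Product.Properties using (Σ-≡,≡←≡)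
  open import Data.Empty using (⊥-elim)
  open import Relation.Nullary using (¬_; Dec; yes; no; ¬?; _×-dec_)
  open import Relation.Binary.PropositionalEquality
  open import Relation.Binary.PropositionalEquality.Properties using (subst-subst-sym; subst-sym-subst)
  open import Algebra.Structures using (IsCommutativeRing; IsAbelianGroup)
  open import Algebra.Bundles using (Ring; AbelianGroup)
  open import Function.Bundles using (Inverse)
  open import Function.Definitions using (Injective)
  open Arithmetic using (∑; ∑-join; ∑-split; ∑-split-join; ∑-join-split)

  open FiniteField F renaming (_+_ to _⊕_; _*_ to _⊗_; -_ to ⊖_)
  open VectorSpace F public
  open IsCommutativeRing isCommutativeRing
    using (+-assoc; +-comm; +-identityˡ; +-identityʳ; -‿inverseʳ; -‿inverseˡ;
           *-assoc; *-comm; *-identityˡ; distribˡ; distribʳ; zeroˡ; zeroʳ; isRing)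

  K : Set
  K = Carrier

  open Inverse enumeration using (to; from; strictlyInverseˡ; strictlyInverseʳ)

  _≟K_ : (x y : K) → Dec (x ≡ y)
  x ≟K y with from x Fin.≟ from y
  ... | yes p = yes (trans (sym (strictlyInverseˡ x)) (trans (cong to p) (strictlyInverseˡ y)))
  ... | no np = no (λ e → np (cong from e))

  _≟V_ : ∀ {n} (u v : V n) → Dec (u ≡ v)
  _≟V_ = ≡-dec _≟K_

  2≤q : 2 ℕ.≤ q
  2≤q = twoDistinct q (from 0#) (from 1#) (λ e → 0≢1 (trans (sym (strictlyInverseˡ 0#)) (trans (cong to e) (strictlyInverseˡ 1#))))
    where
      twoDistinct : ∀ m (a b : Fin m) → ¬ a ≡ b → 2 ℕ.≤ m
      twoDistinct (suc zero) zero zero a≢b = ⊥-elim (a≢b refl)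
      twoDistinct (suc (suc _)) _ _ _ = s≤s (s≤s z≤n)

  open Arithmetic.Powers q 2≤q using (q^-positive)

  -V_ : ∀ {n} → V n → V n
  -V_ = map ⊖_

  +V-isAbelianGroup : ∀ n → IsAbelianGroup _≡_ (_+V_ {n}) zeroV -V_
  +V-isAbelianGroup n = record
    { isGroup = record
      { isMonoid = record
        { isSemigroup = record
          { isMagma = record { isEquivalence = isEquivalence ; ∙-cong = cong₂ _+V_ }
          ; assoc = zipWith-assoc +-assoc }
        ; identity = zipWith-identityˡ +-identityˡ , zipWith-identityʳ +-identityʳ }
      ; inverse = zipWith-inverseˡ -‿inverseˡ , zipWith-inverseʳ -‿inverseʳ
      ; ⁻¹-cong = cong -V_ }
    ; comm = zipWith-comm +-comm }

  Vᴳ : ℕ → AbelianGroup 0ℓ 0ℓ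
  Vᴳ n = record { isAbelianGroup = +V-isAbelianGroup n }

  module VecGroup {n : ℕ} where
    open AbelianGroup (Vᴳ n) public using ()
      renaming (identityˡ to +V-identityˡ; identityʳ to +V-identityʳ; inverseʳ to +V-inverseʳ)
    open import Algebra.Properties.AbelianGroup (Vᴳ n) public
      using (x∙y⁻¹≈ε⇒x≈y; inverseˡ-unique; ⁻¹-∙-comm)
    open import Algebra.Properties.CommutativeSemigroup (AbelianGroup.commutativeSemigroup (Vᴳ n)) public
      using (interchange)
  open VecGroup

  ·V-distribˡ : ∀ {n} a (u v : V n) → a ·V (u +V v) ≡ (a ·V u) +V (a ·V v)
  ·V-distribˡ a [] [] = refl
  ·V-distribˡ a (x ∷ u) (y ∷ v) = cong₂ _∷_ (distribˡ a x y) (·V-distribˡ a u v)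

  ·V-distribʳ : ∀ {n} a b (v : V n) → (a ⊕ b) ·V v ≡ (a ·V v) +V (b ·V v)
  ·V-distribʳ a b [] = refl
  ·V-distribʳ a b (x ∷ v) = cong₂ _∷_ (distribʳ x a b) (·V-distribʳ a b v)

  ·V-assoc : ∀ {n} a b (v : V n) → (a ⊗ b) ·V v ≡ a ·V (b ·V v)
  ·V-assoc a b [] = refl
  ·V-assoc a b (x ∷ v) = cong₂ _∷_ (*-assoc a b x) (·V-assoc a b v)

  ·V-identity : ∀ {n} (v : V n) → 1# ·V v ≡ v
  ·V-identity [] = refl
  ·V-identity (x ∷ v) = cong₂ _∷_ (*-identityˡ x) (·V-identity v)

  ·V-zeroˡ : ∀ {n} (v : V n) → 0# ·V v ≡ zeroV
  ·V-zeroˡ [] = refl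
  ·V-zeroˡ (x ∷ v) = cong₂ _∷_ (zeroˡ x) (·V-zeroˡ v)

  ·V-zeroʳ : ∀ {n} a → a ·V zeroV {n} ≡ zeroV
  ·V-zeroʳ {zero} a = refl
  ·V-zeroʳ {suc n} a = cong₂ _∷_ (zeroʳ a) (·V-zeroʳ {n} a)

  ·V-negate : ∀ {n} a (v : V n) → (⊖ a) ·V v ≡ -V (a ·V v)
  ·V-negate a [] = refl
  ·V-negate a (x ∷ v) = cong₂ _∷_ (sym (-‿distribˡ-* a x)) (·V-negate a v)
    where
      R : Ring 0ℓ 0ℓ
      R = record { isRing = isRing }
      open import Algebra.Properties.Ring R using (-‿distribˡ-*)

  difference-swap : ∀ {n} (u v u' v' : V n) → u +V v ≡ u' +V v' → u +V (-V u') ≡ v' +V (-V v)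
  difference-swap u v u' v' e = begin
      u +V (-V u')                         ≡⟨ sym (+V-identityʳ _) ⟩
      (u +V (-V u')) +V zeroV              ≡⟨ cong ((u +V (-V u')) +V_) (sym (+V-inverseʳ v)) ⟩
      (u +V (-V u')) +V (v +V (-V v))      ≡⟨ interchange u (-V u') v (-V v) ⟩
      (u +V v) +V ((-V u') +V (-V v))      ≡⟨ cong (_+V ((-V u') +V (-V v))) e ⟩
      (u' +V v') +V ((-V u') +V (-V v))    ≡⟨ interchange u' v' (-V u') (-V v) ⟩
      (u' +V (-V u')) +V (v' +V (-V v))    ≡⟨ cong (_+V (v' +V (-V v))) (+V-inverseʳ u') ⟩
      zeroV +V (v' +V (-V v))              ≡⟨ +V-identityˡ _ ⟩
      v' +V (-V v)                         ∎
    where open ≡-Reasoning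

  lincomb-+ : ∀ {n d} (c c' : V d) (B : Vec (V n) d) → lincomb (c +V c') B ≡ lincomb c B +V lincomb c' B
  lincomb-+ [] [] [] = sym (+V-identityˡ zeroV)
  lincomb-+ (x ∷ c) (y ∷ c') (b ∷ B) = begin
      ((x ⊕ y) ·V b) +V lincomb (c +V c') B                    ≡⟨ cong₂ _+V_ (·V-distribʳ x y b) (lincomb-+ c c' B) ⟩
      ((x ·V b) +V (y ·V b)) +V (lincomb c B +V lincomb c' B)  ≡⟨ interchange _ _ _ _ ⟩
      ((x ·V b) +V lincomb c B) +V ((y ·V b) +V lincomb c' B)  ∎
    where open ≡-Reasoning

  lincomb-· : ∀ {n d} a (c : V d) (B : Vec (V n) d) → lincomb (a ·V c) B ≡ a ·V lincomb c B
  lincomb-· a [] [] = sym (·V-zeroʳ a)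
  lincomb-· a (x ∷ c) (b ∷ B) = trans (cong₂ _+V_ (·V-assoc a x b) (lincomb-· a c B)) (sym (·V-distribˡ a _ _))

  lincomb-0 : ∀ {n d} (B : Vec (V n) d) → lincomb zeroV B ≡ zeroV
  lincomb-0 [] = refl
  lincomb-0 (b ∷ B) = trans (cong₂ _+V_ (·V-zeroˡ b) (lincomb-0 B)) (+V-identityˡ zeroV)

  lincomb-neg : ∀ {n d} (c : V d) (B : Vec (V n) d) → lincomb (-V c) B ≡ -V lincomb c B
  lincomb-neg [] [] = inverseˡ-unique zeroV zeroV (+V-identityˡ zeroV)
  lincomb-neg (x ∷ c) (b ∷ B) = trans (cong₂ _+V_ (·V-negate x b) (lincomb-neg c B)) (⁻¹-∙-comm _ _)

  lincomb-- : ∀ {n d} (c c' : V d) (B : Vec (V n) d) → lincomb (c +V (-V c')) B ≡ lincomb c B +V (-V lincomb c' B)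
  lincomb-- c c' B = trans (lincomb-+ c (-V c') B) (cong (lincomb c B +V_) (lincomb-neg c' B))

  lincomb-injective : ∀ {n d} {B : Vec (V n) d} → LinIndep B → ∀ c c' → lincomb c B ≡ lincomb c' B → c ≡ c'
  lincomb-injective {B = B} ind c c' e = x∙y⁻¹≈ε⇒x≈y c c' (ind (c +V (-V c')) (begin
      lincomb (c +V (-V c')) B             ≡⟨ lincomb-- c c' B ⟩
      lincomb c B +V (-V lincomb c' B)     ≡⟨ cong (_+V (-V lincomb c' B)) e ⟩
      lincomb c' B +V (-V lincomb c' B)    ≡⟨ +V-inverseʳ _ ⟩
      zeroV                                ∎))
    where open ≡-Reasoning

  _∈sp_ : ∀ {n k} → V n → Vec (V n) k → Set
  v ∈sp B = ∃ λ c → v ≡ lincomb c B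

  span-+ : ∀ {n k} {u v : V n} {B : Vec (V n) k} → u ∈sp B → v ∈sp B → (u +V v) ∈sp B
  span-+ {B = B} (c , e) (c' , e') = c +V c' , trans (cong₂ _+V_ e e') (sym (lincomb-+ c c' B))

  span-· : ∀ {n k} a {v : V n} {B : Vec (V n) k} → v ∈sp B → (a ·V v) ∈sp B
  span-· a {B = B} (c , e) = a ·V c , trans (cong (a ·V_) e) (sym (lincomb-· a c B))

  span-0 : ∀ {n k} (B : Vec (V n) k) → zeroV ∈sp B
  span-0 B = zeroV , sym (lincomb-0 B)

  anyK? : {P : K → Set} → (∀ x → Dec (P x)) → Dec (∃ P)
  anyK? {P} P? with FinP.any? (λ i → P? (to i))
  ... | yes (i , p) = yes (to i , p)
  ... | no np = no (λ { (x , p) → np (from x , subst P (sym (strictlyInverseˡ x)) p) })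

  anyVec? : ∀ k {P : Vec K k → Set} → (∀ v → Dec (P v)) → Dec (∃ P)
  anyVec? zero P? with P? []
  ... | yes p = yes ([] , p)
  ... | no np = no (λ { ([] , p) → np p })
  anyVec? (suc k) {P} P? with anyK? (λ x → anyVec? k (λ v → P? (x ∷ v)))
  ... | yes (x , v , p) = yes (x ∷ v , p)
  ... | no np = no (λ { (x ∷ v , p) → np (x , v , p) })

  span? : ∀ {n k} (v : V n) (B : Vec (V n) k) → Dec (v ∈sp B)
  span? {k = k} v B = anyVec? k (λ c → v ≟V lincomb c B)

  extend-independent : ∀ {n k} (u : V n) (B : Vec (V n) k) → LinIndep B → ¬ u ∈sp B → LinIndep (u ∷ B)
  extend-independent u B ind u∉B (a ∷ c) e with a ≟K 0#
  ... | yes refl = cong (0# ∷_) (ind c (trans (sym (+V-identityˡ _)) (trans (cong (_+V lincomb c B) (sym (·V-zeroˡ u))) e)))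
  ... | no a≢0 with inverse a a≢0
  ... | b , ab≡1 = ⊥-elim (u∉B (b ·V (-V c) , u∈B))
    where
      open ≡-Reasoning
      u∈B : u ≡ lincomb (b ·V (-V c)) B
      u∈B = begin
        u                          ≡⟨ sym (·V-identity u) ⟩
        1# ·V u                    ≡⟨ cong (_·V u) (sym (trans (*-comm b a) ab≡1)) ⟩
        (b ⊗ a) ·V u               ≡⟨ ·V-assoc b a u ⟩
        b ·V (a ·V u)              ≡⟨ cong (b ·V_) (inverseˡ-unique _ _ e) ⟩
        b ·V (-V lincomb c B)      ≡⟨ cong (b ·V_) (sym (lincomb-neg c B)) ⟩
        b ·V lincomb (-V c) B      ≡⟨ sym (lincomb-· b (-V c) B) ⟩
        lincomb (b ·V (-V c)) B    ∎

  encode : ∀ {k} → Vec K k → Fin (q ^ k)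
  encode [] = zero
  encode (x ∷ v) = combine (from x) (encode v)

  decode : ∀ {k} → Fin (q ^ k) → Vec K k
  decode {zero} _ = []
  decode {suc k} i = let (r , i') = remQuot {q} (q ^ k) i in to r ∷ decode i'

  decode-encode : ∀ {k} (v : Vec K k) → decode (encode v) ≡ v
  decode-encode [] = refl
  decode-encode {suc k} (x ∷ v) =
    trans (cong (λ r → to (proj₁ r) ∷ decode {k} (proj₂ r)) (FinP.remQuot-combine {q} {q ^ k} (from x) (encode v)))
          (cong₂ _∷_ (strictlyInverseˡ x) (decode-encode v))

  encode-decode : ∀ {k} (i : Fin (q ^ k)) → encode {k} (decode i) ≡ i
  encode-decode {zero} zero = refl
  encode-decode {suc k} i =
    trans (cong₂ combine (strictlyInverseʳ (proj₁ (remQuot {q} (q ^ k) i))) (encode-decode {k} (proj₂ (remQuot {q} (q ^ k) i))))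
          (FinP.combine-remQuot {q} (q ^ k) i)

  -- An injection Kᵅ → Kᵞ forces α ≤ γ, since qᵅ ≤ qᵞ.
  injection⇒≤ : ∀ α γ (f : Vec K α → Vec K γ) → (∀ x y → f x ≡ f y → x ≡ y) → α ℕ.≤ γ
  injection⇒≤ α γ f f-inj = ℕP.≮⇒≥ (λ γ<α → ℕP.<⇒≱ (ℕP.^-monoʳ-< q 2≤q γ<α) (FinP.injective⇒≤ g-inj))
    where
      g : Fin (q ^ α) → Fin (q ^ γ)
      g i = encode (f (decode i))
      g-inj : Injective _≡_ _≡_ g
      g-inj {i} {j} e = begin
        i                          ≡⟨ sym (encode-decode {α} i) ⟩
        encode {α} (decode i)      ≡⟨ cong encode (f-inj _ _ (trans (sym (decode-encode _)) (trans (cong (decode {γ}) e) (decode-encode _)))) ⟩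
        encode {α} (decode j)      ≡⟨ encode-decode {α} j ⟩
        j                          ∎
        where open ≡-Reasoning

  independent⇒≤ : ∀ {n α γ} (A : Vec (V n) α) (C : Vec (V n) γ) → LinIndep A →
    (∀ c → lincomb c A ∈sp C) → α ℕ.≤ γ
  independent⇒≤ {α = α} {γ} A C indA A⊆C = injection⇒≤ α γ (λ c → proj₁ (A⊆C c))
    (λ x y e → lincomb-injective indA x y (trans (proj₂ (A⊆C x)) (trans (cong (λ c → lincomb c C) e) (sym (proj₂ (A⊆C y))))))

  -- dim A + dim B ≤ dim C when the spans of independent families A and B lie in
  -- the span of C and meet only in 0: (x , y) ↦ coordinates of Ax + By is injective.
  dimensionSum : ∀ {n α β γ} (A : Vec (V n) α) (B : Vec (V n) β) (C : Vec (V n) γ) →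
    LinIndep A → LinIndep B → (∀ c → lincomb c A ∈sp C) → (∀ c → lincomb c B ∈sp C) →
    (∀ a b → lincomb a A ≡ lincomb b B → lincomb a A ≡ zeroV) → α ℕ.+ β ℕ.≤ γ
  dimensionSum {n} {α} {β} {γ} A B C indA indB A⊆C B⊆C A∩B≡0 = injection⇒≤ (α ℕ.+ β) γ h h-inj
    where
      g : Vec K α → Vec K β → Vec K γ
      g x y = proj₁ (span-+ (A⊆C x) (B⊆C y))
      g-spec : ∀ x y → lincomb x A +V lincomb y B ≡ lincomb (g x y) C
      g-spec x y = proj₂ (span-+ (A⊆C x) (B⊆C y))
      g-inj : ∀ x y x' y' → g x y ≡ g x' y' → (x ≡ x') × (y ≡ y')
      g-inj x y x' y' e = x∙y⁻¹≈ε⇒x≈y x x' Δx≡0 , sym (x∙y⁻¹≈ε⇒x≈y y' y Δy≡0)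
        where
          open ≡-Reasoning
          sameSum : lincomb x A +V lincomb y B ≡ lincomb x' A +V lincomb y' B
          sameSum = trans (g-spec x y) (trans (cong (λ z → lincomb z C) e) (sym (g-spec x' y')))
          ΔA≡ΔB : lincomb (x +V (-V x')) A ≡ lincomb (y' +V (-V y)) B
          ΔA≡ΔB = begin
            lincomb (x +V (-V x')) A                 ≡⟨ lincomb-- x x' A ⟩
            lincomb x A +V (-V lincomb x' A)         ≡⟨ difference-swap _ _ _ _ sameSum ⟩
            lincomb y' B +V (-V lincomb y B)         ≡⟨ sym (lincomb-- y' y B) ⟩
            lincomb (y' +V (-V y)) B                 ∎
          Δx≡0 : x +V (-V x') ≡ zeroV
          Δx≡0 = indA _ (A∩B≡0 (x +V (-V x')) (y' +V (-V y)) ΔA≡ΔB)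
          Δy≡0 : y' +V (-V y) ≡ zeroV
          Δy≡0 = indB _ (trans (sym ΔA≡ΔB) (A∩B≡0 (x +V (-V x')) (y' +V (-V y)) ΔA≡ΔB))
      h : Vec K (α ℕ.+ β) → Vec K γ
      h w = g (take α w) (drop α w)
      h-inj : ∀ w w' → h w ≡ h w' → w ≡ w'
      h-inj w w' e with g-inj _ _ _ _ e
      ... | take≡ , drop≡ = trans (sym (take++drop≡id α w)) (trans (cong₂ _++_ take≡ drop≡) (take++drop≡id α w'))

  record Basis {n : ℕ} (U : V n → Set) : Set where
    constructor mkBasis
    field
      size : ℕ
      vectors : Vec (V n) size
      independent : LinIndep vectors
      inside : ∀ c → U (lincomb c vectors)
      spanning : ∀ v → U v → v ∈sp vectors

  -- Every decidable subspace has a basis: keep adding a vector of U outside the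
  -- current span; independence bounds the number of steps by n.
  basisOf : ∀ {n} (U : V n → Set) → (∀ v → Dec (U v)) → U zeroV →
    (∀ {u v} → U u → U v → U (u +V v)) → (∀ a {v} → U v → U (a ·V v)) → Basis U
  basisOf {n} U U? U0 U+ U· = grow (suc n) 0 (ℕP.+-identityʳ (suc n)) [] (λ { [] _ → refl }) (λ { [] → U0 })
    where
      grow : (fuel k : ℕ) → fuel ℕ.+ k ≡ suc n → (B : Vec (V n) k) → LinIndep B → (∀ c → U (lincomb c B)) → Basis U
      grow zero k e B ind B⊆U =
        ⊥-elim (ℕP.<-irrefl refl (subst (ℕ._≤ n) e (injection⇒≤ k n (λ c → lincomb c B) (lincomb-injective ind))))
      grow (suc fuel) k e B ind B⊆U with anyVec? n (λ v → U? v ×-dec ¬? (span? v B))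
      ... | yes (v , Uv , v∉B) =
        grow fuel (suc k) (trans (ℕP.+-suc fuel k) e) (v ∷ B) (extend-independent v B ind v∉B)
             (λ { (a ∷ c) → U+ (U· a Uv) (B⊆U c) })
      ... | no noneOutside = mkBasis k B ind B⊆U spans
        where
          spans : ∀ v → U v → v ∈sp B
          spans v Uv with span? v B
          ... | yes v∈B = v∈B
          ... | no v∉B = ⊥-elim (noneOutside (v , Uv , v∉B))

  -- The qᵏ - 1 nonzero vectors of Kᵏ, enumerated by punching the code of 0 out of Fin (q ^ k).
  private
    q^k≡ : ∀ k → suc (q ^ k ∸ 1) ≡ q ^ k
    q^k≡ k = ℕP.suc-pred (q ^ k) {{ℕ.>-nonZero (q^-positive k)}}

    encode′ : ∀ {k} → Vec K k → Fin (suc (q ^ k ∸ 1))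
    encode′ {k} v = subst Fin (sym (q^k≡ k)) (encode v)

    decode′ : ∀ {k} → Fin (suc (q ^ k ∸ 1)) → Vec K k
    decode′ {k} i = decode (subst Fin (q^k≡ k) i)

    decode′-encode′ : ∀ {k} (v : Vec K k) → decode′ (encode′ v) ≡ v
    decode′-encode′ {k} v = trans (cong decode (subst-subst-sym (q^k≡ k))) (decode-encode v)

    encode′-decode′ : ∀ {k} (i : Fin (suc (q ^ k ∸ 1))) → encode′ {k} (decode′ i) ≡ i
    encode′-decode′ {k} i = trans (cong (subst Fin (sym (q^k≡ k))) (encode-decode {k} _)) (subst-sym-subst (q^k≡ k))

  nonzero : ∀ k → Fin (q ^ k ∸ 1) → Vec K k
  nonzero k i = decode′ {k} (punchIn (encode′ (zeroV {k})) i)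

  nonzero-≢0 : ∀ k i → ¬ nonzero k i ≡ zeroV
  nonzero-≢0 k i e = FinP.punchInᵢ≢i (encode′ (zeroV {k})) i (trans (sym (encode′-decode′ {k} _)) (cong encode′ e))

  nonzero-injective : ∀ k i j → nonzero k i ≡ nonzero k j → i ≡ j
  nonzero-injective k i j e = FinP.punchIn-injective (encode′ (zeroV {k})) i j
    (trans (sym (encode′-decode′ {k} _)) (trans (cong encode′ e) (encode′-decode′ {k} _)))

  nonzeroIndex : ∀ k (c : Vec K k) → ¬ c ≡ zeroV → Fin (q ^ k ∸ 1)
  nonzeroIndex k c c≢0 = punchOut {i = encode′ (zeroV {k})} {j = encode′ c}
    (λ e → c≢0 (sym (trans (sym (decode′-encode′ zeroV)) (trans (cong decode′ e) (decode′-encode′ c)))))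

  nonzero-nonzeroIndex : ∀ k c c≢0 → nonzero k (nonzeroIndex k c c≢0) ≡ c
  nonzero-nonzeroIndex k c c≢0 = trans (cong decode′ (FinP.punchIn-punchOut _)) (decode′-encode′ c)

  -- Packing: subspaces spanned by independent families B k (k < s) that pairwise
  -- meet only in 0 contain together 1 + ∑ (q^(dims k) - 1) distinct vectors of Kⁿ.
  packingBound : ∀ {n} s (dims : Fin s → ℕ) (B : ∀ k → Vec (V n) (dims k)) → (∀ k → LinIndep (B k)) →
    (∀ v k k' → ¬ v ≡ zeroV → v ∈sp B k → v ∈sp B k' → k ≡ k') →
    suc (∑ s (λ k → q ^ dims k ∸ 1)) ℕ.≤ q ^ n
  packingBound {n} s dims B ind disjoint = FinP.injective⇒≤ {f = λ x → encode (vector x)} vector-inj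
    where
      g : Fin s → ℕ
      g k = q ^ dims k ∸ 1
      member : Σ (Fin s) (λ k → Fin (g k)) → V n
      member (k , i) = lincomb (nonzero (dims k) i) (B k)
      member-≢0 : ∀ p → ¬ member p ≡ zeroV
      member-≢0 (k , i) e = nonzero-≢0 (dims k) i (ind k _ e)
      member-inj : ∀ p p' → member p ≡ member p' → p ≡ p'
      member-inj (k , i) (k' , i') e with disjoint (member (k , i)) k k' (member-≢0 (k , i)) (nonzero (dims k) i , refl) (nonzero (dims k') i' , e)
      ... | refl = cong (k ,_) (nonzero-injective _ i i' (lincomb-injective (ind k) _ _ e))
      vector : Fin (suc (∑ s g)) → V n
      vector zero = zeroV
      vector (suc x) = member (∑-split s g x)
      vector-inj′ : ∀ x y → vector x ≡ vector y → x ≡ y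
      vector-inj′ zero zero e = refl
      vector-inj′ zero (suc y) e = ⊥-elim (member-≢0 _ (sym e))
      vector-inj′ (suc x) zero e = ⊥-elim (member-≢0 _ e)
      vector-inj′ (suc x) (suc y) e =
        cong suc (trans (sym (∑-join-split s g x)) (trans (cong (∑-join s g) (member-inj _ _ e)) (∑-join-split s g y)))
      vector-inj : Injective _≡_ _≡_ (λ x → encode (vector x))
      vector-inj {x} {y} e = vector-inj′ x y (trans (sym (decode-encode (vector x))) (trans (cong (decode {n}) e) (decode-encode (vector y))))

  -- Covering: if every nonzero vector of the span of an independent e-family A lies
  -- in the span of some B j, then the qᵉ - 1 nonzero vectors of ⟨A⟩ inject into the
  -- disjoint union of the nonzero coordinate vectors of the B j.
  coveringBound : ∀ {n e} (A : Vec (V n) e) → LinIndep A → ∀ m (dims : Fin m → ℕ) (B : ∀ j → Vec (V n) (dims j)) →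
    (∀ c → ¬ c ≡ zeroV → ∃ λ j → lincomb c A ∈sp B j) → q ^ e ∸ 1 ℕ.≤ ∑ m (λ j → q ^ dims j ∸ 1)
  coveringBound {n} {e} A indA m dims B covered = FinP.injective⇒≤ {f = λ i → code (locate i)} code∘locate-inj
    where
      g : Fin m → ℕ
      g j = q ^ dims j ∸ 1
      vec : Fin (q ^ e ∸ 1) → V n
      vec i = lincomb (nonzero e i) A
      Location : V n → Set
      Location v = Σ (Fin m) λ j → Σ (Vec K (dims j)) λ c → (v ≡ lincomb c (B j)) × ¬ c ≡ zeroV
      locate : ∀ i → Location (vec i)
      locate i with covered (nonzero e i) (nonzero-≢0 e i)
      ... | j , c , v≡ = j , c , v≡ , λ c≡0 →
        nonzero-≢0 e i (indA _ (trans v≡ (trans (cong (λ z → lincomb z (B j)) c≡0) (lincomb-0 (B j)))))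
      code : ∀ {v} → Location v → Fin (∑ m g)
      code (j , c , _ , c≢0) = ∑-join m g (j , nonzeroIndex (dims j) c c≢0)
      code-inj : ∀ {v v'} (p : Location v) (p' : Location v') → code p ≡ code p' → v ≡ v'
      code-inj (j , c , v≡ , c≢0) (j' , c' , v'≡ , c'≢0) h
        with Σ-≡,≡←≡ (trans (sym (∑-split-join m g (j , nonzeroIndex (dims j) c c≢0)))
                       (trans (cong (∑-split m g) h) (∑-split-join m g (j' , nonzeroIndex (dims j') c' c'≢0))))
      ... | refl , sameIndex = trans v≡ (trans (cong (λ z → lincomb z (B j)) c≡c') (sym v'≡))
        where
          c≡c' : c ≡ c'
          c≡c' = trans (sym (nonzero-nonzeroIndex _ c c≢0))
                   (trans (cong (nonzero (dims j)) sameIndex) (nonzero-nonzeroIndex _ c' c'≢0))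
      code∘locate-inj : Injective _≡_ _≡_ (λ i → code (locate i))
      code∘locate-inj {i} {i'} h = nonzero-injective e i i' (lincomb-injective indA _ _ (code-inj (locate i) (locate i') h))

module FiniteIndexing where

  open import Data.Nat using (zero; suc; _+_; _≤_)
  open import Data.Fin using (Fin; zero; suc; splitAt; join)
  import Data.Fin.Properties as FinP
  open import Data.Sum using (inj₁; inj₂; [_,_]′)
  open import Data.Product using (∃; _,_)
  open import Data.Empty using (⊥-elim)
  open import Relation.Nullary using (¬_; Dec; yes; no)
  open import Relation.Binary.PropositionalEquality
  open import Function.Definitions using (Injective)

  record Enumeration {s : ℕ} (Q : Fin s → Set) : Set where
    field
      size : ℕ
      index : Fin size → Fin s
      injective : Injective _≡_ _≡_ index
      sound : ∀ j → Q (index j)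
      complete : ∀ k → Q k → ∃ λ j → index j ≡ k

  enumerate : ∀ s (Q : Fin s → Set) → (∀ k → Dec (Q k)) → Enumeration Q
  enumerate zero Q Q? = record { size = 0 ; index = λ () ; injective = λ { {()} } ; sound = λ () ; complete = λ () }
  enumerate (suc s) Q Q? with enumerate s (λ k → Q (suc k)) (λ k → Q? (suc k)) | Q? zero
  ... | E | yes Q0 = record { size = suc size ; index = index′ ; injective = index′-inj ; sound = sound′ ; complete = complete′ }
    where
      open Enumeration E
      index′ : Fin (suc size) → Fin (suc s)
      index′ zero = zero
      index′ (suc j) = suc (index j)
      index′-inj : Injective _≡_ _≡_ index′
      index′-inj {zero} {zero} _ = refl
      index′-inj {suc x} {suc y} h = cong suc (injective (FinP.suc-injective h))
      sound′ : ∀ j → Q (index′ j)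
      sound′ zero = Q0
      sound′ (suc j) = sound j
      complete′ : ∀ k → Q k → ∃ λ j → index′ j ≡ k
      complete′ zero _ = zero , refl
      complete′ (suc k) Qk with complete k Qk
      ... | j , refl = suc j , refl
  ... | E | no ¬Q0 = record { size = size ; index = λ j → suc (index j) ; injective = λ h → injective (FinP.suc-injective h)
                             ; sound = sound ; complete = complete′ }
    where
      open Enumeration E
      complete′ : ∀ k → Q k → ∃ λ j → suc (index j) ≡ k
      complete′ zero Q0 = ⊥-elim (¬Q0 Q0)
      complete′ (suc k) Qk with complete k Qk
      ... | j , refl = j , refl

  disjointInjections : ∀ {a b s} (f : Fin a → Fin s) (g : Fin b → Fin s) →
    Injective _≡_ _≡_ f → Injective _≡_ _≡_ g → (∀ i j → ¬ f i ≡ g j) → a + b ≤ s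
  disjointInjections {a} {b} {s} f g f-inj g-inj disjoint = FinP.injective⇒≤ h-inj
    where
      h : Fin (a + b) → Fin s
      h x = [ f , g ]′ (splitAt a x)
      unsplit : ∀ x y → splitAt a x ≡ splitAt a y → x ≡ y
      unsplit x y e = trans (sym (FinP.join-splitAt a b x)) (trans (cong (join a b) e) (FinP.join-splitAt a b y))
      h-inj : Injective _≡_ _≡_ h
      h-inj {x} {y} e with splitAt a x in ex | splitAt a y in ey
      ... | inj₁ i | inj₁ i' = unsplit x y (trans ex (trans (cong inj₁ (f-inj e)) (sym ey)))
      ... | inj₂ j | inj₂ j' = unsplit x y (trans ex (trans (cong inj₂ (g-inj e)) (sym ey)))
      ... | inj₁ i | inj₂ j' = ⊥-elim (disjoint i j' e)
      ... | inj₂ j | inj₁ i' = ⊥-elim (disjoint i' j (sym e))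

module Partitions {q : ℕ} (F : FiniteField q) where

  open import Data.Nat as ℕ using (zero; suc; _+_; _≤_; _<_)
  import Data.Nat.Properties as ℕP
  open import Data.Fin as Fin using (Fin; zero; suc)
  import Data.Fin.Properties as FinP
  open import Data.List using (List; []; _∷_; length; lookup)
  import Data.List.Properties as ListP
  open import Data.List.Relation.Unary.All as All using (All)
  open import Data.List.Membership.Propositional.Properties using (∈-lookup)
  open import Data.Product using (Σ; _×_; _,_)
  open import Data.Empty using (⊥-elim)
  open import Relation.Nullary using (¬_; yes; no)
  open import Relation.Binary.PropositionalEquality
  open import Relation.Binary.PropositionalEquality.Properties using (subst-injective)
  open import Function.Definitions using (Injective)
  open LinearAlgebra F

  lookupAll : ∀ {A : Set} {Q : A → Set} {xs : List A} → All Q xs → (i : Fin (length xs)) → Q (lookup xs i)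
  lookupAll Qxs i = All.lookup Qxs (∈-lookup i)

  membersOfDim : ∀ {n} d (L : List (Subspace n)) → Σ (Fin (count d L) → Fin (length L)) λ ι →
    Injective _≡_ _≡_ ι × (∀ j → dim (lookup L (ι j)) ≡ d)
  membersOfDim d [] = (λ ()) , (λ { {()} }) , (λ ())
  membersOfDim d (X ∷ L) with dim X ℕ.≟ d | membersOfDim d L
  ... | yes dimX≡d | ι , ι-inj , ι-dim =
        (λ j → ι′ (subst Fin count≡ j)) , (λ h → subst-injective count≡ (ι′-inj h)) , (λ j → ι′-dim (subst Fin count≡ j))
    where
      count≡ : count d (X ∷ L) ≡ suc (count d L)
      count≡ = cong length (ListP.filter-accept (λ S → dim S ℕ.≟ d) dimX≡d)
      ι′ : Fin (suc (count d L)) → Fin (suc (length L))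
      ι′ zero = zero
      ι′ (suc j) = suc (ι j)
      ι′-inj : Injective _≡_ _≡_ ι′
      ι′-inj {zero} {zero} _ = refl
      ι′-inj {suc x} {suc y} h = cong suc (ι-inj (FinP.suc-injective h))
      ι′-dim : ∀ j → dim (lookup (X ∷ L) (ι′ j)) ≡ d
      ι′-dim zero = dimX≡d
      ι′-dim (suc j) = ι-dim j
  ... | no dimX≢d | ι , ι-inj , ι-dim =
        (λ j → suc (ι (subst Fin count≡ j))) , (λ h → subst-injective count≡ (ι-inj (FinP.suc-injective h))) , (λ j → ι-dim (subst Fin count≡ j))
    where
      count≡ : count d (X ∷ L) ≡ count d L
      count≡ = cong length (ListP.filter-reject (λ S → dim S ℕ.≟ d) dimX≢d)

  uniqueMember : ∀ {n} {L : List (Subspace n)} → IsVSPartition L → ∀ v → ¬ v ≡ zeroV →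
    ∀ i j → v ∈S lookup L i → v ∈S lookup L j → i ≡ j
  uniqueMember (_ , cover) v v≢0 i j v∈i v∈j with cover v v≢0
  ... | _ , _ , unique = trans (unique i v∈i) (sym (unique j v∈j))

  membersDisjoint : ∀ {n} {L : List (Subspace n)} → IsVSPartition L → ∀ i j → ¬ i ≡ j →
    ∀ v → v ∈S lookup L i → v ∈S lookup L j → v ≡ zeroV
  membersDisjoint L-part i j i≢j v v∈i v∈j with v ≟V zeroV
  ... | yes v≡0 = v≡0
  ... | no v≢0 = ⊥-elim (i≢j (uniqueMember L-part v v≢0 i j v∈i v∈j))

  _⊆_ : ∀ {n} → Subspace n → Subspace n → Set
  X ⊆ W = ∀ c → lincomb c (basis X) ∈S W

  sharedContainer : ∀ {n} {L : List (Subspace n)} → IsVSPartition L → ∀ i j (W : Subspace n) →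
    lookup L i ⊆ W → lookup L j ⊆ W → dim W < dim (lookup L i) + dim (lookup L j) → i ≡ j
  sharedContainer {L = L} L-part i j W i⊆W j⊆W tooBig with i Fin.≟ j
  ... | yes i≡j = i≡j
  ... | no i≢j = ⊥-elim (ℕP.<⇒≱ tooBig
          (dimensionSum (basis (lookup L i)) (basis (lookup L j)) (basis W) (indep (lookup L i)) (indep (lookup L j)) i⊆W j⊆W
            (λ a b same → membersDisjoint L-part i j i≢j _ (a , refl) (b , same))))

module SpreadSetting {q : ℕ} (F : FiniteField q) (t : ℕ) (1≤t : 1 ≤ t)
  (P : List (VectorSpace.Subspace F (2 * t))) (P-part : VectorSpace.IsVSPartition F P)
  (S : List (VectorSpace.Subspace F (2 * t))) (S-spread : VectorSpace.IsSpread F t S)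
  (inSpread : All (λ X → VectorSpace.dimension F X ≡ t → Any (λ Y → VectorSpace.SameSubspace F X Y) S) P)
  (a : ℕ) (count-t : VectorSpace.count F t P + a ≡ q ^ t + 1)
  (d : ℕ) (t<2d : t < 2 * d) (d<t : d < t) where

  open import Data.Nat as ℕ using (suc; _∸_; ⌈_/2⌉)
  import Data.Nat.Properties as ℕP
  open import Data.Fin as Fin using (Fin)
  import Data.Fin.Properties as FinP
  open import Data.Vec using (Vec; _∷_)
  open import Data.List using (length; lookup)
  import Data.List.Relation.Unary.Any as Any
  open import Data.List.Relation.Unary.Any.Properties using (lookup-index)
  open import Data.Product using (∃; _×_; _,_; proj₁; proj₂)
  open import Data.Empty using (⊥-elim)
  open import Relation.Nullary using (¬_; yes; no; ¬?; _×-dec_)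
  open import Function.Definitions using (Injective)
  open import Relation.Binary.PropositionalEquality
  open LinearAlgebra F
  open Partitions F
  open FiniteIndexing
  open Arithmetic using (∑; ∑-cong; ∑-const; spreadSizeBound)
  open Arithmetic.Powers q 2≤q using (q^-≥2; smallPiecesBound)

  n : ℕ
  n = 2 * t

  s : ℕ
  s = length S

  W : Fin s → Subspace n
  W k = lookup S k

  S-part : IsVSPartition S
  S-part = proj₁ S-spread

  dimW : ∀ k → dim (W k) ≡ t
  dimW = lookupAll (proj₂ S-spread)

  1≤d : 1 ≤ d
  1≤d = ℕP.n≢0⇒n>0 (λ d≡0 → ℕP.n≮0 (subst (λ z → t < 2 * z) d≡0 t<2d))

  t≢d : ¬ t ≡ d
  t≢d t≡d = ℕP.<-irrefl (sym t≡d) d<t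

  -- The spread members are t-dimensional and pairwise meet in 0, so packingBound
  -- gives 1 + s (qᵗ - 1) ≤ q²ᵗ, i.e. s ≤ qᵗ + 1.
  spreadSize : s ≤ suc (q ^ t)
  spreadSize = spreadSizeBound s (q ^ t) (q^-≥2 t 1≤t) (subst₂ _≤_ vectorCount q^n≡
    (packingBound s (λ k → dim (W k)) (λ k → basis (W k)) (λ k → indep (W k)) (λ v k k' v≢0 → uniqueMember S-part v v≢0 k k')))
    where
      vectorCount : suc (∑ s (λ k → q ^ dim (W k) ∸ 1)) ≡ suc (s * (q ^ t ∸ 1))
      vectorCount = cong suc (trans (∑-cong s (λ k → cong (λ z → q ^ z ∸ 1) (dimW k))) (∑-const s _))
      q^n≡ : q ^ n ≡ q ^ t * q ^ t
      q^n≡ = trans (cong (λ z → q ^ (t + z)) (ℕP.+-identityʳ t)) (ℕP.^-distribˡ-+-* q t t)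

  sameHost : ∀ i j k → lookup P i ⊆ W k → lookup P j ⊆ W k → t < dim (lookup P i) + dim (lookup P j) → i ≡ j
  sameHost i j k i⊆Wk j⊆Wk overfull = sharedContainer P-part i j (W k) i⊆Wk j⊆Wk (subst (_< _) (sym (dimW k)) overfull)

  ct : ℕ
  ct = count t P

  ιT : Fin ct → Fin (length P)
  ιT = proj₁ (membersOfDim t P)

  ιT-inj : Injective _≡_ _≡_ ιT
  ιT-inj = proj₁ (proj₂ (membersOfDim t P))

  ιT-dim : ∀ j → dim (lookup P (ιT j)) ≡ t
  ιT-dim = proj₂ (proj₂ (membersOfDim t P))

  X : Fin ct → Subspace n
  X j = lookup P (ιT j)

  matched : Fin ct → Fin s
  matched j = Any.index (lookupAll inSpread (ιT j) (ιT-dim j))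

  X≡W : ∀ j → SameSubspace (X j) (W (matched j))
  X≡W j = lookup-index (lookupAll inSpread (ιT j) (ιT-dim j))

  X⊆W : ∀ j → X j ⊆ W (matched j)
  X⊆W j c = proj₁ (X≡W j _) (c , refl)

  matched-inj : Injective _≡_ _≡_ matched
  matched-inj {j} {j'} h = ιT-inj (sameHost (ιT j) (ιT j') (matched j') (subst (λ k → X j ⊆ W k) h (X⊆W j)) (X⊆W j')
    (subst (t <_) (sym (cong₂ _+_ (ιT-dim j) (ιT-dim j'))) (ℕP.m<m+n t 1≤t)))

  -- Any injective family of unmatched spread members has at most a members,
  -- since ct + (its size) ≤ s ≤ qᵗ + 1 = ct + a.
  unmatchedBound : ∀ {b} (g : Fin b → Fin s) → Injective _≡_ _≡_ g → (∀ i j → ¬ matched i ≡ g j) → b ≤ a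
  unmatchedBound {b} g g-inj unmatched = ℕP.+-cancelˡ-≤ ct b a (begin
      ct + b          ≤⟨ disjointInjections matched g matched-inj g-inj unmatched ⟩
      s               ≤⟨ spreadSize ⟩
      suc (q ^ t)     ≡⟨ trans (ℕP.+-comm 1 (q ^ t)) (sym count-t) ⟩
      ct + a          ∎)
    where open ℕP.≤-Reasoning

  module MemberOfDimD (iD : Fin (length P)) (dimD : dim (lookup P iD) ≡ d) where

    D : Subspace n
    D = lookup P iD

    BD : Vec (V n) (dim D)
    BD = basis D

    Meets : Fin s → Set
    Meets k = ∃ λ c → ¬ c ≡ zeroV × lincomb c BD ∈S W k

    -- (abstract: only the specification of the enumeration and of the bases below
    -- matters, and unfolding the search procedures would slow type checking down)
    abstract
      meeting : Enumeration Meets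
      meeting = enumerate s Meets (λ k → anyVec? (dim D) (λ c → ¬? (c ≟V zeroV) ×-dec span? (lincomb c BD) (basis (W k))))

    open Enumeration meeting using () renaming (size to m; index to e; injective to e-inj; sound to e-meets; complete to e-complete)

    -- A matched spread member equals a t-member of P, which shares no nonzero vector with D.
    meeting-unmatched : ∀ i j → ¬ matched i ≡ e j
    meeting-unmatched i j h with e-meets j
    ... | c , c≢0 , c∈W = t≢d (trans (sym (ιT-dim i)) (trans (cong (λ k → dim (lookup P k)) same) dimD))
      where
        same : ιT i ≡ iD
        same = uniqueMember P-part (lincomb c BD) (λ e → c≢0 (indep D c e)) (ιT i) iD
          (proj₂ (X≡W i _) (subst (λ k → lincomb c BD ∈S W k) (sym h) c∈W)) (c , refl)

    m≤a : m ≤ a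
    m≤a = unmatchedBound e e-inj meeting-unmatched

    abstract
      intersection : ∀ j → Basis (λ v → v ∈S D × v ∈S W (e j))
      intersection j = basisOf _ (λ v → span? v BD ×-dec span? v (basis (W (e j))))
        (span-0 _ , span-0 _) (λ x y → span-+ (proj₁ x) (proj₁ y) , span-+ (proj₂ x) (proj₂ y))
        (λ a x → span-· a (proj₁ x) , span-· a (proj₂ x))

    f : Fin m → ℕ
    f j = Basis.size (intersection j)

    Bs : ∀ j → Vec (V n) (f j)
    Bs j = Basis.vectors (intersection j)

    Bs⊆D : ∀ j c → lincomb c (Bs j) ∈S D
    Bs⊆D j c = proj₁ (Basis.inside (intersection j) c)

    Bs⊆W : ∀ j c → lincomb c (Bs j) ∈S W (e j)
    Bs⊆W j c = proj₂ (Basis.inside (intersection j) c)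

    -- Distinct intersections lie in distinct spread members, so they meet only in 0.
    intersections-pairwise : ∀ j j' → ¬ j ≡ j' → f j + f j' ≤ d
    intersections-pairwise j j' j≢j' = subst (f j + f j' ≤_) dimD
      (dimensionSum (Bs j) (Bs j') BD (Basis.independent (intersection j)) (Basis.independent (intersection j'))
        (Bs⊆D j) (Bs⊆D j')
        (λ x y same → membersDisjoint S-part (e j) (e j') (λ h → j≢j' (e-inj h)) _
           (Bs⊆W j x) (subst (_∈S W (e j')) (sym same) (Bs⊆W j' y))))

    -- Each nonzero vector of D lies in the spread member containing it, which meets D.
    intersections-cover : ∀ c → ¬ c ≡ zeroV → ∃ λ j → lincomb c BD ∈sp Bs j
    intersections-cover c c≢0 with proj₂ S-part (lincomb c BD) (λ e → c≢0 (indep D c e))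
    ... | k , v∈Wk , _ with e-complete k (c , c≢0 , v∈Wk)
    ... | j , refl = j , Basis.spanning (intersection j) _ ((c , refl) , v∈Wk)

    -- An intersection of dimension at least d is all of D: otherwise a vector of D
    -- outside it would extend its basis to d + 1 independent vectors of D.
    full-intersection : ∀ j → d ≤ f j → D ⊆ W (e j)
    full-intersection j d≤fj c with span? (lincomb c BD) (Bs j)
    ... | yes (c' , v≡) = subst (_∈S W (e j)) (sym v≡) (Bs⊆W j c')
    ... | no v∉Bs = ⊥-elim (ℕP.<-irrefl refl (ℕP.≤-trans (ℕP.≤-trans tooMany (ℕP.≤-reflexive dimD)) d≤fj))
      where
        tooMany : suc (f j) ≤ dim D
        tooMany = independent⇒≤ (lincomb c BD ∷ Bs j) BD
          (extend-independent _ (Bs j) (Basis.independent (intersection j)) v∉Bs)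
          (λ { (x ∷ y) → span-+ (span-· x (c , refl)) (Bs⊆D j y) })

    -- If a ≤ q^⌈d/2⌉ then D lies in a spread member.  Otherwise all f j < d, and
    -- counting the nonzero vectors of D (coveringBound) contradicts smallPiecesBound.
    containedInSpread : a ≤ q ^ ⌈ d /2⌉ → ∃ λ k → D ⊆ W k
    containedInSpread a≤ with FinP.any? (λ j → d ℕ.≤? f j)
    ... | yes (j , d≤fj) = e j , full-intersection j d≤fj
    ... | no noneFull = ⊥-elim (ℕP.<⇒≱ few many)
      where
        few : ∑ m (λ j → q ^ f j ∸ 1) < q ^ d ∸ 1
        few = smallPiecesBound m d f 1≤d (ℕP.≤-trans m≤a a≤) (λ j → ℕP.≰⇒> (λ d≤fj → noneFull (j , d≤fj))) intersections-pairwise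
        many : q ^ d ∸ 1 ≤ ∑ m (λ j → q ^ f j ∸ 1)
        many = subst (λ z → q ^ z ∸ 1 ≤ ∑ m (λ j → q ^ f j ∸ 1)) dimD (coveringBound BD (indep D) m f Bs intersections-cover)

  -- If a ≤ q^⌈d/2⌉, the d-dimensional members of P lie in distinct unmatched spread
  -- members (by sameHost, as t < d + d and t < t + d), so there are at most a of them.
  dimD-count : a ≤ q ^ ⌈ d /2⌉ → count d P ≤ a
  dimD-count a≤ = unmatchedBound host host-inj host-unmatched
    where
      ιD : Fin (count d P) → Fin (length P)
      ιD = proj₁ (membersOfDim d P)
      ιD-inj : Injective _≡_ _≡_ ιD
      ιD-inj = proj₁ (proj₂ (membersOfDim d P))
      ιD-dim : ∀ j → dim (lookup P (ιD j)) ≡ d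
      ιD-dim = proj₂ (proj₂ (membersOfDim d P))
      host : Fin (count d P) → Fin s
      host j = proj₁ (MemberOfDimD.containedInSpread (ιD j) (ιD-dim j) a≤)
      D⊆host : ∀ j → lookup P (ιD j) ⊆ W (host j)
      D⊆host j = proj₂ (MemberOfDimD.containedInSpread (ιD j) (ιD-dim j) a≤)
      host-inj : Injective _≡_ _≡_ host
      host-inj {j} {j'} h = ιD-inj (sameHost (ιD j) (ιD j') (host j') (subst (λ k → lookup P (ιD j) ⊆ W k) h (D⊆host j)) (D⊆host j')
        (subst (t <_) (trans (cong (d +_) (ℕP.+-identityʳ d)) (sym (cong₂ _+_ (ιD-dim j) (ιD-dim j')))) t<2d))
      host-unmatched : ∀ i j → ¬ matched i ≡ host j
      host-unmatched i j h = t≢d (trans (sym (ιT-dim i)) (trans (cong (λ k → dim (lookup P k)) same) (ιD-dim j)))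
        where
          same : ιT i ≡ ιD j
          same = sameHost (ιT i) (ιD j) (host j) (subst (λ k → X i ⊆ W k) h (X⊆W i)) (D⊆host j)
            (subst (t <_) (sym (cong₂ _+_ (ιT-dim i) (ιD-dim j))) (ℕP.m<m+n t 1≤d))

proposition8 : (q : ℕ) → IsPrimePower q → (F : FiniteField q) → (t : ℕ) → 1 ≤ t →
    (P : List (VectorSpace.Subspace F (2 * t))) → VectorSpace.IsVSPartition F P →
    (a d m_d : ℕ) → t < 2 * d → d < t →
    VectorSpace.count F t P + a ≡ q ^ t + 1 →
    VectorSpace.count F d P ≡ m_d →
    (Σ (List (VectorSpace.Subspace F (2 * t))) λ S → VectorSpace.IsSpread F t S ×
       All (λ X → VectorSpace.dimension F X ≡ t → Any (λ Y → VectorSpace.SameSubspace F X Y) S) P) →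
    m_d ⊓ (q ^ ⌈ d /2⌉ + 1) ≤ a
proposition8 q _ F t 1≤t P P-part a d m_d t<2d d<t count-t count-d (S , S-spread , inSpread)
  with a ℕP.≤? q ^ ⌈ d /2⌉
... | yes a≤ = ℕP.≤-trans (ℕP.m⊓n≤m m_d _)
                 (subst (_≤ a) count-d (SpreadSetting.dimD-count F t 1≤t P P-part S S-spread inSpread a count-t d t<2d d<t a≤))
... | no a≰ = ℕP.≤-trans (ℕP.m⊓n≤n m_d _) (subst (_≤ a) (ℕP.+-comm 1 (q ^ ⌈ d /2⌉)) (ℕP.≰⇒> a≰))
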